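{- The reduction $\triangleright$ on combinators is confluent: whenever $t\triangleright^* t_1$ and $t\triangleright^* t_2$, there is $t_3$ with $t_1\triangleright^* t_3$ and $t_2\triangleright^* t_3$.
   Context: Combinators: $C ::= x \mid K \mid S \mid I \mid (C\ C)$ with $x$ ranging over variables; application associates to the left. $\lambda x.u$ is defined by the first applicable rule: $\lambda x.u=(K\ u)$ if $x$ does not occur in $u$; $\lambda x.x=I$; $\lambda x.(u\ v)=(S\ \lambda x.u\ \lambda x.v)$ otherwise. Here $\triangleright$ is the closure under application contexts of the rules $(K\ u\ v)\triangleright u$, $(S\ u\ v\ w)\triangleright(u\ w\ (v\ w))$, $(I\ u)\triangleright u$, $(S\ (K\ u)\ (K\ v))\triangleright(K\ (u\ v))$, plus the rule: $\lambda x.u\triangleright\lambda x.v$ whenever $u\triangleright v$. $\triangleright^*$ is the reflexive–transitive closure. -}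

module Defs where

open import Data.Nat using (ℕ; _≟_)
open import Data.Bool using (Bool; true; false; _∨_)
open import Relation.Nullary using (does)
open import Relation.Binary.Construct.Closure.ReflexiveTransitive using (Star)

infixl 9 _·_
data Comb : Set where
  var : ℕ → Comb
  K S I : Comb
  _·_ : Comb → Comb → Comb

occurs : ℕ → Comb → Bool
occurs x (var y) = does (x ≟ y)
occurs x K = false
occurs x S = false
occurs x I = false
occurs x (u · v) = occurs x u ∨ occurs x v

lam : ℕ → Comb → Comb
lam x u with occurs x u
lam x u | false = K · u
lam x (var y) | true = I   -- occurs x (var y) = true forces y = x
lam x K | true = K · K     -- unreachable (occurs x K = false)
lam x S | true = K · S     -- unreachable
lam x I | true = K · I     -- unreachable
lam x (u · v) | true = S · lam x u · lam x v

infix 4 _▷_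
data _▷_ : Comb → Comb → Set where
  K-red  : ∀ u v → K · u · v ▷ u
  S-red  : ∀ u v w → S · u · v · w ▷ u · w · (v · w)
  I-red  : ∀ u → I · u ▷ u
  SK-red : ∀ u v → S · (K · u) · (K · v) ▷ K · (u · v)
  app-l  : ∀ {u u′} v → u ▷ u′ → u · v ▷ u′ · v
  app-r  : ∀ u {v v′} → v ▷ v′ → u · v ▷ u · v′
  lam-red : ∀ x {u v} → u ▷ v → lam x u ▷ lam x v

infix 4 _▷*_
_▷*_ : Comb → Comb → Set
_▷*_ = Star _▷_

-- Combinators are translated into a λ-calculus with constants K and S, where I becomes
-- λx.x and two extra rules, K M ⇒ λ_.M and S (λM) (λN) ⇒ λ(M N), let the ξ-rule on bracket
-- abstractions be expressed.  Parallel reduction of this calculus has Takahashi's triangle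
-- property, hence is confluent.  Every ▷-step becomes a conversion between translations;
-- conversely, reading λ-terms back into combinators by bracket abstraction turns every
-- parallel step into ▷*, and reads the translation of t back as t.  So the translations of
-- t₁ and t₂ have a common reduct, whose read-back is a common ▷-reduct of t₁ and t₂.

module Submission where

open import Data.Bool using (true; false; _∨_; if_then_else_)
open import Data.Bool.Properties using (∨-conicalˡ; ∨-conicalʳ)
open import Data.Empty using (⊥-elim)
open import Data.Maybe as Maybe using (Maybe; just; nothing)
open import Data.Nat using (ℕ; suc; _≟_; _⊔_; _≤_; _<_)
open import Data.Nat.Properties
  using (>⇒≢; m≤m⊔n; m≤n⊔m; m⊔n≤o⇒m≤o; m⊔n≤o⇒n≤o; m⊔n<o⇒m<o; m⊔n<o⇒n<o)
open import Data.Product using (Σ; ∃; _×_; _,_; -,_)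
open import Function using (_∘_; id)
open import Relation.Binary.PropositionalEquality
  using (_≡_; _≗_; refl; sym; trans; cong; cong₂; subst; subst₂; module ≡-Reasoning)
open import Relation.Binary.Construct.Closure.ReflexiveTransitive as Star
  using (Star; ε; _◅_; _◅◅_)
open import Relation.Binary.Construct.Closure.ReflexiveTransitive.Properties using (reflexive)
open import Relation.Binary.Construct.Closure.Symmetric using (fwd; bwd)
open import Relation.Binary.Construct.Closure.Equivalence as Eq using (EqClosure)
open import Relation.Binary.Construct.Closure.Equivalence.Properties using (a—↠b⇒a↔b; a—↠b⇒b↔a)
open import Relation.Binary.Rewriting using (Confluent)
open import Relation.Nullary using (Dec; yes; no; ¬_; _×-dec_)
open import Relation.Nullary.Decidable using (dec-true; dec-false)

open import Defs

private variable A B C : Set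

module _ {X : Set} {_⟶_ : X → X → Set} where

  diamond⇒confluent : (∀ {a b c} → a ⟶ b → a ⟶ c → ∃ λ d → b ⟶ d × c ⟶ d) →
                      Confluent _⟶_
  diamond⇒confluent diamond = confluent
    where
    strip : ∀ {a b c} → a ⟶ b → Star _⟶_ a c → ∃ λ d → Star _⟶_ b d × c ⟶ d
    strip r ε = -, ε , r
    strip r (s ◅ ss) with diamond r s
    ... | _ , r′ , s′ with strip s′ ss
    ...   | _ , rs , s″ = -, r′ ◅ rs , s″

    confluent : Confluent _⟶_
    confluent ε ss = -, ss , ε
    confluent (r ◅ rs) ss with strip r ss
    ... | _ , ss′ , r′ with confluent rs ss′
    ...   | _ , rs′ , ss″ = -, rs′ , r′ ◅ ss″

  confluent⇒joinable : Confluent _⟶_ → ∀ {a b} → EqClosure _⟶_ a b →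
                       ∃ λ c → Star _⟶_ a c × Star _⟶_ b c
  confluent⇒joinable conf ε = -, ε , ε
  confluent⇒joinable conf (fwd r ◅ rs) with confluent⇒joinable conf rs
  ... | _ , as , bs = -, r ◅ as , bs
  confluent⇒joinable conf (bwd r ◅ rs) with confluent⇒joinable conf rs
  ... | _ , as , bs with conf (r ◅ ε) as
  ...   | _ , as′ , cs = -, as′ , bs ◅◅ cs

-- λ-calculus with constants

infixl 9 _∙_
infix  8 `_
data Lam (V : Set) : Set where
  `_  : V → Lam V
  Kₗ Sₗ : Lam V
  _∙_ : Lam V → Lam V → Lam V
  ƛ   : Lam (Maybe V) → Lam V

ren : (A → B) → Lam A → Lam B
ren f (` a) = ` f a
ren f Kₗ = Kₗ
ren f Sₗ = Sₗ
ren f (M ∙ N) = ren f M ∙ ren f N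
ren f (ƛ M) = ƛ (ren (Maybe.map f) M)

wk : Lam A → Lam (Maybe A)
wk = ren just

lifts : (A → Lam B) → Maybe A → Lam (Maybe B)
lifts σ nothing = ` nothing
lifts σ (just a) = wk (σ a)

sub : (A → Lam B) → Lam A → Lam B
sub σ (` a) = σ a
sub σ Kₗ = Kₗ
sub σ Sₗ = Sₗ
sub σ (M ∙ N) = sub σ M ∙ sub σ N
sub σ (ƛ M) = ƛ (sub (lifts σ) M)

single : Lam A → Maybe A → Lam A
single N = Maybe.maybe′ `_ N

_[_] : Lam (Maybe A) → Lam A → Lam A
M [ N ] = sub (single N) M

map-cong : {f g : A → B} → f ≗ g → Maybe.map f ≗ Maybe.map g
map-cong f≗g nothing = refl
map-cong f≗g (just a) = cong just (f≗g a)

ren-cong : {f g : A → B} → f ≗ g → ren f ≗ ren g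
ren-cong f≗g (` a) = cong `_ (f≗g a)
ren-cong f≗g Kₗ = refl
ren-cong f≗g Sₗ = refl
ren-cong f≗g (M ∙ N) = cong₂ _∙_ (ren-cong f≗g M) (ren-cong f≗g N)
ren-cong f≗g (ƛ M) = cong ƛ (ren-cong (map-cong f≗g) M)

lifts-cong : {σ τ : A → Lam B} → σ ≗ τ → lifts σ ≗ lifts τ
lifts-cong σ≗τ nothing = refl
lifts-cong σ≗τ (just a) = cong wk (σ≗τ a)

sub-cong : {σ τ : A → Lam B} → σ ≗ τ → sub σ ≗ sub τ
sub-cong σ≗τ (` a) = σ≗τ a
sub-cong σ≗τ Kₗ = refl
sub-cong σ≗τ Sₗ = refl
sub-cong σ≗τ (M ∙ N) = cong₂ _∙_ (sub-cong σ≗τ M) (sub-cong σ≗τ N)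
sub-cong σ≗τ (ƛ M) = cong ƛ (sub-cong (lifts-cong σ≗τ) M)

map-∘ : (g : B → C) (f : A → B) → Maybe.map g ∘ Maybe.map f ≗ Maybe.map (g ∘ f)
map-∘ g f nothing = refl
map-∘ g f (just a) = refl

ren-ren : (g : B → C) (f : A → B) → ren g ∘ ren f ≗ ren (g ∘ f)
ren-ren g f (` a) = refl
ren-ren g f Kₗ = refl
ren-ren g f Sₗ = refl
ren-ren g f (M ∙ N) = cong₂ _∙_ (ren-ren g f M) (ren-ren g f N)
ren-ren g f (ƛ M) =
  cong ƛ (trans (ren-ren (Maybe.map g) (Maybe.map f) M) (ren-cong (map-∘ g f) M))

sub-ren : (σ : B → Lam C) (f : A → B) → sub σ ∘ ren f ≗ sub (σ ∘ f)
sub-ren σ f (` a) = refl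
sub-ren σ f Kₗ = refl
sub-ren σ f Sₗ = refl
sub-ren σ f (M ∙ N) = cong₂ _∙_ (sub-ren σ f M) (sub-ren σ f N)
sub-ren σ f (ƛ M) = cong ƛ (trans (sub-ren (lifts σ) (Maybe.map f) M) (sub-cong lifts-map M))
  where
  lifts-map : lifts σ ∘ Maybe.map f ≗ lifts (σ ∘ f)
  lifts-map nothing = refl
  lifts-map (just a) = refl

ren-sub : (g : B → C) (σ : A → Lam B) → ren g ∘ sub σ ≗ sub (ren g ∘ σ)
ren-sub g σ (` a) = refl
ren-sub g σ Kₗ = refl
ren-sub g σ Sₗ = refl
ren-sub g σ (M ∙ N) = cong₂ _∙_ (ren-sub g σ M) (ren-sub g σ N)
ren-sub g σ (ƛ M) = cong ƛ (trans (ren-sub (Maybe.map g) (lifts σ) M) (sub-cong ren-lifts M))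
  where
  ren-lifts : ren (Maybe.map g) ∘ lifts σ ≗ lifts (ren g ∘ σ)
  ren-lifts nothing = refl
  ren-lifts (just a) = trans (ren-ren (Maybe.map g) just (σ a)) (sym (ren-ren just g (σ a)))

sub-sub : (τ : B → Lam C) (σ : A → Lam B) → sub τ ∘ sub σ ≗ sub (sub τ ∘ σ)
sub-sub τ σ (` a) = refl
sub-sub τ σ Kₗ = refl
sub-sub τ σ Sₗ = refl
sub-sub τ σ (M ∙ N) = cong₂ _∙_ (sub-sub τ σ M) (sub-sub τ σ N)
sub-sub τ σ (ƛ M) = cong ƛ (trans (sub-sub (lifts τ) (lifts σ) M) (sub-cong sub-lifts M))
  where
  sub-lifts : sub (lifts τ) ∘ lifts σ ≗ lifts (sub τ ∘ σ)
  sub-lifts nothing = refl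
  sub-lifts (just a) = trans (sub-ren (lifts τ) just (σ a)) (sym (ren-sub just τ (σ a)))

sub-id : sub {A} `_ ≗ id
sub-id (` a) = refl
sub-id Kₗ = refl
sub-id Sₗ = refl
sub-id (M ∙ N) = cong₂ _∙_ (sub-id M) (sub-id N)
sub-id (ƛ M) = cong ƛ (trans (sub-cong lifts-var M) (sub-id M))
  where
  lifts-var : lifts {A} `_ ≗ `_
  lifts-var nothing = refl
  lifts-var (just a) = refl

ren-[] : (f : A → B) (M : Lam (Maybe A)) (N : Lam A) →
         ren f (M [ N ]) ≡ ren (Maybe.map f) M [ ren f N ]
ren-[] f M N =
  trans (ren-sub f _ M) (sym (trans (sub-ren _ (Maybe.map f) M) (sub-cong ren-single M)))
  where
  ren-single : single (ren f N) ∘ Maybe.map f ≗ ren f ∘ single N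
  ren-single nothing = refl
  ren-single (just a) = refl

sub-[] : (σ : A → Lam B) (M : Lam (Maybe A)) (N : Lam A) →
         sub σ (M [ N ]) ≡ sub (lifts σ) M [ sub σ N ]
sub-[] σ M N =
  trans (sub-sub σ _ M) (sym (trans (sub-sub _ (lifts σ) M) (sub-cong sub-single M)))
  where
  sub-single : sub (single (sub σ N)) ∘ lifts σ ≗ sub σ ∘ single N
  sub-single nothing = refl
  sub-single (just a) = trans (sub-ren _ just (σ a)) (sub-id (σ a))

ren-wk : (f : A → B) (M : Lam A) → ren (Maybe.map f) (wk M) ≡ wk (ren f M)
ren-wk f M = trans (ren-ren (Maybe.map f) just M) (sym (ren-ren just f M))

sub-wk : (σ : A → Lam B) (M : Lam A) → sub (lifts σ) (wk M) ≡ wk (sub σ M)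
sub-wk σ M = trans (sub-ren (lifts σ) just M) (sym (ren-sub just σ M))

wk-[] : (M N : Lam A) → wk M [ N ] ≡ M
wk-[] M N = trans (sub-ren _ just M) (sub-id M)

-- Parallel reduction and complete development

-- ⇛-K₁ and ⇛-Sƛ are the bracket-abstraction equations K u = λx.u and
-- S (λx.u) (λx.v) = λx.(u v) read as reductions; ⇛-Sƛβ is ⇛-Sƛ followed by ⇛-β, so that
-- develop can contract S (λM) (λN) P in a single step.
infix 4 _⇛_
data _⇛_ {V : Set} : Lam V → Lam V → Set where
  ⇛-var : ∀ {a} → ` a ⇛ ` a
  ⇛-K   : Kₗ ⇛ Kₗ
  ⇛-S   : Sₗ ⇛ Sₗ
  ⇛-app : ∀ {M M′ N N′} → M ⇛ M′ → N ⇛ N′ → M ∙ N ⇛ M′ ∙ N′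
  ⇛-ƛ   : ∀ {M M′} → M ⇛ M′ → ƛ M ⇛ ƛ M′
  ⇛-β   : ∀ {M M′ N N′} → M ⇛ M′ → N ⇛ N′ → ƛ M ∙ N ⇛ M′ [ N′ ]
  ⇛-K₁  : ∀ {M M′} → M ⇛ M′ → Kₗ ∙ M ⇛ ƛ (wk M′)
  ⇛-K₂  : ∀ {M M′ N} → M ⇛ M′ → Kₗ ∙ M ∙ N ⇛ M′
  ⇛-S₃  : ∀ {M M′ N N′ P P′} → M ⇛ M′ → N ⇛ N′ → P ⇛ P′ →
          Sₗ ∙ M ∙ N ∙ P ⇛ M′ ∙ P′ ∙ (N′ ∙ P′)
  ⇛-Sƛ  : ∀ {M M′ N N′} → M ⇛ M′ → N ⇛ N′ → Sₗ ∙ ƛ M ∙ ƛ N ⇛ ƛ (M′ ∙ N′)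
  ⇛-Sƛβ : ∀ {M M′ N N′ P P′} → M ⇛ M′ → N ⇛ N′ → P ⇛ P′ →
          Sₗ ∙ ƛ M ∙ ƛ N ∙ P ⇛ (M′ ∙ N′) [ P′ ]

⇛-refl : (M : Lam A) → M ⇛ M
⇛-refl (` a) = ⇛-var
⇛-refl Kₗ = ⇛-K
⇛-refl Sₗ = ⇛-S
⇛-refl (M ∙ N) = ⇛-app (⇛-refl M) (⇛-refl N)
⇛-refl (ƛ M) = ⇛-ƛ (⇛-refl M)

⇛-≡ : {M N N′ : Lam A} → M ⇛ N → N ≡ N′ → M ⇛ N′
⇛-≡ r refl = r

⇛-ren : (f : A → B) {M M′ : Lam A} → M ⇛ M′ → ren f M ⇛ ren f M′
⇛-ren f ⇛-var = ⇛-var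
⇛-ren f ⇛-K = ⇛-K
⇛-ren f ⇛-S = ⇛-S
⇛-ren f (⇛-app r s) = ⇛-app (⇛-ren f r) (⇛-ren f s)
⇛-ren f (⇛-ƛ r) = ⇛-ƛ (⇛-ren (Maybe.map f) r)
⇛-ren f (⇛-β {M′ = M′} {N′ = N′} r s) =
  ⇛-≡ (⇛-β (⇛-ren (Maybe.map f) r) (⇛-ren f s)) (sym (ren-[] f M′ N′))
⇛-ren f (⇛-K₁ {M′ = M′} r) = ⇛-≡ (⇛-K₁ (⇛-ren f r)) (cong ƛ (sym (ren-wk f M′)))
⇛-ren f (⇛-K₂ r) = ⇛-K₂ (⇛-ren f r)
⇛-ren f (⇛-S₃ r s t) = ⇛-S₃ (⇛-ren f r) (⇛-ren f s) (⇛-ren f t)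
⇛-ren f (⇛-Sƛ r s) = ⇛-Sƛ (⇛-ren (Maybe.map f) r) (⇛-ren (Maybe.map f) s)
⇛-ren f (⇛-Sƛβ {M′ = M′} {N′ = N′} {P′ = P′} r s t) =
  ⇛-≡ (⇛-Sƛβ (⇛-ren (Maybe.map f) r) (⇛-ren (Maybe.map f) s) (⇛-ren f t))
      (sym (ren-[] f (M′ ∙ N′) P′))

_⇛ₛ_ : (A → Lam B) → (A → Lam B) → Set
σ ⇛ₛ τ = ∀ a → σ a ⇛ τ a

⇛ₛ-lifts : {σ τ : A → Lam B} → σ ⇛ₛ τ → lifts σ ⇛ₛ lifts τ
⇛ₛ-lifts σ⇛τ nothing = ⇛-var
⇛ₛ-lifts σ⇛τ (just a) = ⇛-ren just (σ⇛τ a)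

⇛-sub : {σ τ : A → Lam B} → σ ⇛ₛ τ → {M M′ : Lam A} → M ⇛ M′ → sub σ M ⇛ sub τ M′
⇛-sub σ⇛τ (⇛-var {a}) = σ⇛τ a
⇛-sub σ⇛τ ⇛-K = ⇛-K
⇛-sub σ⇛τ ⇛-S = ⇛-S
⇛-sub σ⇛τ (⇛-app r s) = ⇛-app (⇛-sub σ⇛τ r) (⇛-sub σ⇛τ s)
⇛-sub σ⇛τ (⇛-ƛ r) = ⇛-ƛ (⇛-sub (⇛ₛ-lifts σ⇛τ) r)
⇛-sub {τ = τ} σ⇛τ (⇛-β {M′ = M′} {N′ = N′} r s) =
  ⇛-≡ (⇛-β (⇛-sub (⇛ₛ-lifts σ⇛τ) r) (⇛-sub σ⇛τ s)) (sym (sub-[] τ M′ N′))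
⇛-sub {τ = τ} σ⇛τ (⇛-K₁ {M′ = M′} r) = ⇛-≡ (⇛-K₁ (⇛-sub σ⇛τ r)) (cong ƛ (sym (sub-wk τ M′)))
⇛-sub σ⇛τ (⇛-K₂ r) = ⇛-K₂ (⇛-sub σ⇛τ r)
⇛-sub σ⇛τ (⇛-S₃ r s t) = ⇛-S₃ (⇛-sub σ⇛τ r) (⇛-sub σ⇛τ s) (⇛-sub σ⇛τ t)
⇛-sub σ⇛τ (⇛-Sƛ r s) = ⇛-Sƛ (⇛-sub (⇛ₛ-lifts σ⇛τ) r) (⇛-sub (⇛ₛ-lifts σ⇛τ) s)
⇛-sub {τ = τ} σ⇛τ (⇛-Sƛβ {M′ = M′} {N′ = N′} {P′ = P′} r s t) =
  ⇛-≡ (⇛-Sƛβ (⇛-sub (⇛ₛ-lifts σ⇛τ) r) (⇛-sub (⇛ₛ-lifts σ⇛τ) s) (⇛-sub σ⇛τ t))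
      (sym (sub-[] τ (M′ ∙ N′) P′))

⇛-[] : {M M′ : Lam (Maybe A)} {N N′ : Lam A} → M ⇛ M′ → N ⇛ N′ → M [ N ] ⇛ M′ [ N′ ]
⇛-[] r s = ⇛-sub single⇛ r
  where
  single⇛ : single _ ⇛ₛ single _
  single⇛ nothing = s
  single⇛ (just a) = ⇛-var

IsƛPair : Lam A → Lam A → Set
IsƛPair M N = ∃ (λ M₀ → M ≡ ƛ M₀) × ∃ (λ N₀ → N ≡ ƛ N₀)

-- The redex develop contracts at an application.  plain is admissible for any application,
-- since ⇛-develop treats it uniformly; S₃ records that Sƛβ does not apply, which excludes an
-- inner ⇛-Sƛ step.
data Redex {V : Set} : Lam V → Lam V → Set where
  β     : ∀ M N → Redex (ƛ M) N
  K₁    : ∀ N → Redex Kₗ N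
  K₂    : ∀ M N → Redex (Kₗ ∙ M) N
  Sƛ    : ∀ M N → Redex (Sₗ ∙ ƛ M) (ƛ N)
  Sƛβ   : ∀ M N P → Redex (Sₗ ∙ ƛ M ∙ ƛ N) P
  S₃    : ∀ M N P → ¬ IsƛPair M N → Redex (Sₗ ∙ M ∙ N) P
  plain : ∀ M N → Redex M N

ƛ? : (M : Lam A) → Dec (∃ λ M₀ → M ≡ ƛ M₀)
ƛ? (ƛ M) = yes (M , refl)
ƛ? (` _) = no λ ()
ƛ? Kₗ = no λ ()
ƛ? Sₗ = no λ ()
ƛ? (_ ∙ _) = no λ ()

redex : (M N : Lam A) → Redex M N
redex (ƛ M) N = β M N
redex Kₗ N = K₁ N
redex (Kₗ ∙ M) N = K₂ M N
redex (Sₗ ∙ ƛ M) (ƛ N) = Sƛ M N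
redex (Sₗ ∙ M ∙ N) P with ƛ? M ×-dec ƛ? N
... | yes ((M₀ , refl) , (N₀ , refl)) = Sƛβ M₀ N₀ P
... | no notƛ = S₃ M N P notƛ
redex M N = plain M N

develop : Lam A → Lam A
develop (` a) = ` a
develop Kₗ = Kₗ
develop Sₗ = Sₗ
develop (ƛ M) = ƛ (develop M)
develop (M ∙ N) with redex M N
... | β M N = develop M [ develop N ]
... | K₁ N = ƛ (wk (develop N))
... | K₂ M N = develop M
... | Sƛ M N = ƛ (develop M ∙ develop N)
... | Sƛβ M N P = (develop M ∙ develop N) [ develop P ]
... | S₃ M N P _ = develop M ∙ develop P ∙ (develop N ∙ develop P)
... | plain M N = develop M ∙ develop N

⇛-develop : {M N : Lam A} → M ⇛ N → N ⇛ develop M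
⇛-develop ⇛-var = ⇛-var
⇛-develop ⇛-K = ⇛-K
⇛-develop ⇛-S = ⇛-S
⇛-develop (⇛-ƛ r) = ⇛-ƛ (⇛-develop r)
⇛-develop (⇛-β r s) = ⇛-[] (⇛-develop r) (⇛-develop s)
⇛-develop (⇛-K₁ r) = ⇛-ƛ (⇛-ren just (⇛-develop r))
⇛-develop (⇛-K₂ r) = ⇛-develop r
⇛-develop (⇛-Sƛ r s) = ⇛-ƛ (⇛-app (⇛-develop r) (⇛-develop s))
⇛-develop (⇛-Sƛβ r s t) = ⇛-[] (⇛-app (⇛-develop r) (⇛-develop s)) (⇛-develop t)
⇛-develop (⇛-S₃ {M = M} {N = N} r s t) with ƛ? M ×-dec ƛ? N
⇛-develop (⇛-S₃ (⇛-ƛ r) (⇛-ƛ s) t) | yes ((_ , refl) , (_ , refl)) =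
  ⇛-app (⇛-β (⇛-develop r) (⇛-develop t)) (⇛-β (⇛-develop s) (⇛-develop t))
... | no _ = ⇛-app (⇛-app (⇛-develop r) (⇛-develop t)) (⇛-app (⇛-develop s) (⇛-develop t))
⇛-develop (⇛-app {M = M} {N = N} r s) with redex M N
⇛-develop (⇛-app (⇛-ƛ r) s) | β _ _ = ⇛-β (⇛-develop r) (⇛-develop s)
⇛-develop (⇛-app ⇛-K s) | K₁ _ = ⇛-K₁ (⇛-develop s)
⇛-develop (⇛-app (⇛-app ⇛-K r) s) | K₂ _ _ = ⇛-K₂ (⇛-develop r)
⇛-develop (⇛-app (⇛-K₁ r) s) | K₂ _ _ =
  ⇛-≡ (⇛-β (⇛-ren just (⇛-develop r)) (⇛-develop s)) (wk-[] _ _)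
⇛-develop (⇛-app (⇛-app ⇛-S (⇛-ƛ r)) (⇛-ƛ s)) | Sƛ _ _ = ⇛-Sƛ (⇛-develop r) (⇛-develop s)
⇛-develop (⇛-app (⇛-app (⇛-app ⇛-S (⇛-ƛ r)) (⇛-ƛ s)) t) | Sƛβ _ _ _ =
  ⇛-Sƛβ (⇛-develop r) (⇛-develop s) (⇛-develop t)
⇛-develop (⇛-app (⇛-Sƛ r s) t) | Sƛβ _ _ _ = ⇛-β (⇛-app (⇛-develop r) (⇛-develop s)) (⇛-develop t)
⇛-develop (⇛-app (⇛-app (⇛-app ⇛-S r) s) t) | S₃ _ _ _ _ =
  ⇛-S₃ (⇛-develop r) (⇛-develop s) (⇛-develop t)
⇛-develop (⇛-app (⇛-Sƛ _ _) _) | S₃ _ _ _ notƛ = ⊥-elim (notƛ ((-, refl) , (-, refl)))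
⇛-develop (⇛-app r s) | plain _ _ = ⇛-app (⇛-develop r) (⇛-develop s)

⇛-confluent : Confluent (_⇛_ {A})
⇛-confluent = diamond⇒confluent λ r s → -, ⇛-develop r , ⇛-develop s

-- Bracket abstraction

lam-fresh : ∀ {x u} → occurs x u ≡ false → lam x u ≡ K · u
lam-fresh {x} {u} x∉u with occurs x u
... | false = refl

lam-var : ∀ {x y} → occurs x (var y) ≡ true → lam x (var y) ≡ I
lam-var {x} {y} x∈y with occurs x (var y)
... | true = refl

lam-app : ∀ {x u v} → occurs x (u · v) ≡ true → lam x (u · v) ≡ S · lam x u · lam x v
lam-app {x} {u} {v} x∈uv with occurs x (u · v)
... | true = refl

occurs-self : ∀ x → occurs x (var x) ≡ true
occurs-self x = dec-true (x ≟ x) refl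

maxVar : Comb → ℕ
maxVar (var n) = n
maxVar K = 0
maxVar S = 0
maxVar I = 0
maxVar (u · v) = maxVar u ⊔ maxVar v

occurs-maxVar : ∀ {x} u → maxVar u < x → occurs x u ≡ false
occurs-maxVar {x} (var n) n<x = dec-false (x ≟ n) (>⇒≢ n<x)
occurs-maxVar K _ = refl
occurs-maxVar S _ = refl
occurs-maxVar I _ = refl
occurs-maxVar (u · v) uv<x
  rewrite occurs-maxVar u (m⊔n<o⇒m<o (maxVar u) _ uv<x)
        | occurs-maxVar v (m⊔n<o⇒n<o _ (maxVar v) uv<x) = refl

infixl 9 _⊛_
infix  10 #_
data CL (V : Set) : Set where
  #_       : V → CL V
  Kᶜ Sᶜ Iᶜ : CL V
  _⊛_      : CL V → CL V → CL V

strengthen : CL (Maybe A) → Maybe (CL A)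
strengthen (# nothing) = nothing
strengthen (# just a) = just (# a)
strengthen Kᶜ = just Kᶜ
strengthen Sᶜ = just Sᶜ
strengthen Iᶜ = just Iᶜ
strengthen (a ⊛ b) = Maybe.zipWith _⊛_ (strengthen a) (strengthen b)

-- The clauses of lam, where strengthening decides whether the bound variable occurs.
Λ : CL (Maybe A) → CL A
Λ (# nothing) = Iᶜ
Λ (# just a) = Kᶜ ⊛ # a
Λ Kᶜ = Kᶜ ⊛ Kᶜ
Λ Sᶜ = Kᶜ ⊛ Sᶜ
Λ Iᶜ = Kᶜ ⊛ Iᶜ
Λ (a ⊛ b) with strengthen (a ⊛ b)
... | just ab = Kᶜ ⊛ ab
... | nothing = Sᶜ ⊛ Λ a ⊛ Λ b

Λ-strengthen : (b : CL (Maybe A)) {b′ : CL A} → strengthen b ≡ just b′ → Λ b ≡ Kᶜ ⊛ b′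
Λ-strengthen (# just a) refl = refl
Λ-strengthen Kᶜ refl = refl
Λ-strengthen Sᶜ refl = refl
Λ-strengthen Iᶜ refl = refl
Λ-strengthen (a ⊛ b) eq with strengthen (a ⊛ b)
Λ-strengthen (a ⊛ b) refl | just _ = refl

⟦_⟧ : CL A → (A → Comb) → Comb
⟦ # a ⟧ ρ = ρ a
⟦ Kᶜ ⟧ ρ = K
⟦ Sᶜ ⟧ ρ = S
⟦ Iᶜ ⟧ ρ = I
⟦ a ⊛ b ⟧ ρ = ⟦ a ⟧ ρ · ⟦ b ⟧ ρ

_,,_ : (A → Comb) → Comb → Maybe A → Comb
ρ ,, c = Maybe.maybe′ ρ c

⟦⟧-cong : {ρ ρ′ : A → Comb} → ρ ≗ ρ′ → (b : CL A) → ⟦ b ⟧ ρ ≡ ⟦ b ⟧ ρ′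
⟦⟧-cong ρ≗ρ′ (# a) = ρ≗ρ′ a
⟦⟧-cong ρ≗ρ′ Kᶜ = refl
⟦⟧-cong ρ≗ρ′ Sᶜ = refl
⟦⟧-cong ρ≗ρ′ Iᶜ = refl
⟦⟧-cong ρ≗ρ′ (a ⊛ b) = cong₂ _·_ (⟦⟧-cong ρ≗ρ′ a) (⟦⟧-cong ρ≗ρ′ b)

⟦strengthen⟧ : (b : CL (Maybe A)) {b′ : CL A} → strengthen b ≡ just b′ →
               ∀ ρ c → ⟦ b ⟧ (ρ ,, c) ≡ ⟦ b′ ⟧ ρ
⟦strengthen⟧ (# just a) refl ρ c = refl
⟦strengthen⟧ Kᶜ refl ρ c = refl
⟦strengthen⟧ Sᶜ refl ρ c = refl
⟦strengthen⟧ Iᶜ refl ρ c = refl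
⟦strengthen⟧ (a ⊛ b) eq ρ c with strengthen a in eq-a | strengthen b in eq-b
⟦strengthen⟧ (a ⊛ b) refl ρ c | just _ | just _ =
  cong₂ _·_ (⟦strengthen⟧ a eq-a ρ c) (⟦strengthen⟧ b eq-b ρ c)

bound : CL (Maybe A) → (A → Comb) → ℕ
bound (# nothing) ρ = 0
bound (# just a) ρ = suc (maxVar (ρ a))
bound Kᶜ ρ = 0
bound Sᶜ ρ = 0
bound Iᶜ ρ = 0
bound (a ⊛ b) ρ = bound a ρ ⊔ bound b ρ

is-nothing-zipWith : {X Y Z : Set} (f : X → Y → Z) (x : Maybe X) (y : Maybe Y) →
  Maybe.is-nothing (Maybe.zipWith f x y) ≡ Maybe.is-nothing x ∨ Maybe.is-nothing y
is-nothing-zipWith f (just x) (just y) = refl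
is-nothing-zipWith f (just x) nothing = refl
is-nothing-zipWith f nothing y = refl

occurs-⟦⟧ : (b : CL (Maybe A)) (ρ : A → Comb) {z : ℕ} → bound b ρ ≤ z →
            occurs z (⟦ b ⟧ (ρ ,, var z)) ≡ Maybe.is-nothing (strengthen b)
occurs-⟦⟧ (# nothing) ρ {z} _ = occurs-self z
occurs-⟦⟧ (# just a) ρ b<z = occurs-maxVar (ρ a) b<z
occurs-⟦⟧ Kᶜ ρ _ = refl
occurs-⟦⟧ Sᶜ ρ _ = refl
occurs-⟦⟧ Iᶜ ρ _ = refl
occurs-⟦⟧ (a ⊛ b) ρ ab≤z = trans
  (cong₂ _∨_ (occurs-⟦⟧ a ρ (m⊔n≤o⇒m≤o (bound a ρ) _ ab≤z))
             (occurs-⟦⟧ b ρ (m⊔n≤o⇒n≤o _ (bound b ρ) ab≤z)))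
  (sym (is-nothing-zipWith _⊛_ (strengthen a) (strengthen b)))

⟦Λ⟧≡lam : (b : CL (Maybe A)) (ρ : A → Comb) {z : ℕ} → bound b ρ ≤ z →
          ⟦ Λ b ⟧ ρ ≡ lam z (⟦ b ⟧ (ρ ,, var z))
⟦Λ⟧≡lam (# nothing) ρ {z} _ = sym (lam-var (occurs-self z))
⟦Λ⟧≡lam (# just a) ρ b<z = sym (lam-fresh (occurs-maxVar (ρ a) b<z))
⟦Λ⟧≡lam Kᶜ ρ _ = refl
⟦Λ⟧≡lam Sᶜ ρ _ = refl
⟦Λ⟧≡lam Iᶜ ρ _ = refl
⟦Λ⟧≡lam (a ⊛ b) ρ {z} ab≤z with strengthen (a ⊛ b) in eq | occurs-⟦⟧ (a ⊛ b) ρ ab≤z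
... | just ab | z∉ab =
  sym (trans (lam-fresh z∉ab) (cong (K ·_) (⟦strengthen⟧ (a ⊛ b) eq ρ (var z))))
... | nothing | z∈ab = trans
  (cong₂ (λ u v → S · u · v) (⟦Λ⟧≡lam a ρ (m⊔n≤o⇒m≤o (bound a ρ) _ ab≤z))
                             (⟦Λ⟧≡lam b ρ (m⊔n≤o⇒n≤o _ (bound b ρ) ab≤z)))
  (sym (lam-app z∈ab))

-- ⟦ Λ b ⟧ ρ is lam z _ for every large enough z, so a z fresh for both sides transfers R.
⟦Λ⟧-resp : (R : Comb → Comb → Set) → (∀ x {u v} → R u v → R (lam x u) (lam x v)) →
           (b : CL (Maybe A)) (b′ : CL (Maybe B)) (ρ : A → Comb) (ρ′ : B → Comb) →
           (∀ c → R (⟦ b ⟧ (ρ ,, c)) (⟦ b′ ⟧ (ρ′ ,, c))) → R (⟦ Λ b ⟧ ρ) (⟦ Λ b′ ⟧ ρ′)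
⟦Λ⟧-resp R lam-resp b b′ ρ ρ′ b~b′ =
  subst₂ R (sym (⟦Λ⟧≡lam b ρ (m≤m⊔n _ _))) (sym (⟦Λ⟧≡lam b′ ρ′ (m≤n⊔m _ _)))
           (lam-resp z (b~b′ (var z)))
  where z = bound b ρ ⊔ bound b′ ρ′

⟦Λ⟧-const : (b : CL (Maybe A)) (ρ : A → Comb) {u : Comb} →
            (∀ c → ⟦ b ⟧ (ρ ,, c) ≡ u) → ⟦ Λ b ⟧ ρ ≡ K · u
⟦Λ⟧-const b ρ {u} b≡u = begin
  ⟦ Λ b ⟧ ρ                   ≡⟨ ⟦Λ⟧≡lam b ρ (m≤m⊔n _ _) ⟩
  lam z (⟦ b ⟧ (ρ ,, var z))  ≡⟨ cong (lam z) (b≡u (var z)) ⟩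
  lam z u                     ≡⟨ lam-fresh (occurs-maxVar u (m≤n⊔m (bound b ρ) _)) ⟩
  K · u                       ∎
  where
  open ≡-Reasoning
  z = bound b ρ ⊔ suc (maxVar u)

app* : ∀ {u u′ v v′} → u ▷* u′ → v ▷* v′ → u · v ▷* u′ · v′
app* {u′ = u′} {v = v} r s = Star.gmap (_· v) (app-l v) r ◅◅ Star.gmap (u′ ·_) (app-r u′) s

⟦Λ⟧-β : (b : CL (Maybe A)) (ρ : A → Comb) (c : Comb) → ⟦ Λ b ⟧ ρ · c ▷* ⟦ b ⟧ (ρ ,, c)
⟦Λ⟧-β (# nothing) ρ c = I-red c ◅ ε
⟦Λ⟧-β (# just a) ρ c = K-red (ρ a) c ◅ ε
⟦Λ⟧-β Kᶜ ρ c = K-red K c ◅ ε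
⟦Λ⟧-β Sᶜ ρ c = K-red S c ◅ ε
⟦Λ⟧-β Iᶜ ρ c = K-red I c ◅ ε
⟦Λ⟧-β (a ⊛ b) ρ c with strengthen (a ⊛ b) in eq
... | just ab = K-red _ c ◅ reflexive _▷_ (sym (⟦strengthen⟧ (a ⊛ b) eq ρ c))
... | nothing = S-red _ _ c ◅ app* (⟦Λ⟧-β a ρ c) (⟦Λ⟧-β b ρ c)

⟦Λ⟧-S : (a b : CL (Maybe A)) (ρ : A → Comb) → S · ⟦ Λ a ⟧ ρ · ⟦ Λ b ⟧ ρ ▷* ⟦ Λ (a ⊛ b) ⟧ ρ
⟦Λ⟧-S a b ρ with strengthen a in eq-a | strengthen b in eq-b
... | just _ | just _ rewrite Λ-strengthen a eq-a | Λ-strengthen b eq-b = SK-red _ _ ◅ ε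
... | just _ | nothing = ε
... | nothing | _ = ε

-- Reading λ-terms back as combinators

toCL : Lam A → CL A
toCL (` a) = # a
toCL Kₗ = Kᶜ
toCL Sₗ = Sᶜ
toCL (M ∙ N) = toCL M ⊛ toCL N
toCL (ƛ M) = Λ (toCL M)

⟦toCL-ren⟧ : (f : A → B) (M : Lam A) (ρ : B → Comb) →
             ⟦ toCL (ren f M) ⟧ ρ ≡ ⟦ toCL M ⟧ (ρ ∘ f)
⟦toCL-ren⟧ f (` a) ρ = refl
⟦toCL-ren⟧ f Kₗ ρ = refl
⟦toCL-ren⟧ f Sₗ ρ = refl
⟦toCL-ren⟧ f (M ∙ N) ρ = cong₂ _·_ (⟦toCL-ren⟧ f M ρ) (⟦toCL-ren⟧ f N ρ)
⟦toCL-ren⟧ f (ƛ M) ρ =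
  ⟦Λ⟧-resp _≡_ (λ x → cong (lam x)) (toCL (ren (Maybe.map f) M)) (toCL M) ρ (ρ ∘ f) λ c →
  trans (⟦toCL-ren⟧ (Maybe.map f) M (ρ ,, c)) (⟦⟧-cong (extend-map c) (toCL M))
  where
  extend-map : ∀ c → (ρ ,, c) ∘ Maybe.map f ≗ (ρ ∘ f) ,, c
  extend-map c nothing = refl
  extend-map c (just a) = refl

⟦toCL-sub⟧ : (σ : A → Lam B) (M : Lam A) (ρ : B → Comb) →
             ⟦ toCL (sub σ M) ⟧ ρ ≡ ⟦ toCL M ⟧ (λ a → ⟦ toCL (σ a) ⟧ ρ)
⟦toCL-sub⟧ σ (` a) ρ = refl
⟦toCL-sub⟧ σ Kₗ ρ = refl
⟦toCL-sub⟧ σ Sₗ ρ = refl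
⟦toCL-sub⟧ σ (M ∙ N) ρ = cong₂ _·_ (⟦toCL-sub⟧ σ M ρ) (⟦toCL-sub⟧ σ N ρ)
⟦toCL-sub⟧ σ (ƛ M) ρ =
  ⟦Λ⟧-resp _≡_ (λ x → cong (lam x)) (toCL (sub (lifts σ) M)) (toCL M) ρ _ λ c →
  trans (⟦toCL-sub⟧ (lifts σ) M (ρ ,, c)) (⟦⟧-cong (extend-lifts c) (toCL M))
  where
  extend-lifts : ∀ c → (λ a → ⟦ toCL (lifts σ a) ⟧ (ρ ,, c)) ≗ (λ a → ⟦ toCL (σ a) ⟧ ρ) ,, c
  extend-lifts c nothing = refl
  extend-lifts c (just a) = ⟦toCL-ren⟧ just (σ a) (ρ ,, c)

⟦toCL-[]⟧ : (M : Lam (Maybe A)) (N : Lam A) (ρ : A → Comb) →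
            ⟦ toCL (M [ N ]) ⟧ ρ ≡ ⟦ toCL M ⟧ (ρ ,, ⟦ toCL N ⟧ ρ)
⟦toCL-[]⟧ M N ρ = trans (⟦toCL-sub⟧ (single N) M ρ) (⟦⟧-cong extend-single (toCL M))
  where
  extend-single : (λ a → ⟦ toCL (single N a) ⟧ ρ) ≗ ρ ,, ⟦ toCL N ⟧ ρ
  extend-single nothing = refl
  extend-single (just a) = refl

⟦toCL⟧-β : (M : Lam (Maybe A)) (N : Lam A) (ρ : A → Comb) →
           ⟦ toCL (ƛ M ∙ N) ⟧ ρ ▷* ⟦ toCL (M [ N ]) ⟧ ρ
⟦toCL⟧-β M N ρ = ⟦Λ⟧-β (toCL M) ρ _ ◅◅ reflexive _▷_ (sym (⟦toCL-[]⟧ M N ρ))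

⇛⇒▷* : {M N : Lam A} → M ⇛ N → (ρ : A → Comb) → ⟦ toCL M ⟧ ρ ▷* ⟦ toCL N ⟧ ρ

ƛ⇛⇒▷* : {M M′ : Lam (Maybe A)} → M ⇛ M′ → (ρ : A → Comb) →
        ⟦ toCL (ƛ M) ⟧ ρ ▷* ⟦ toCL (ƛ M′) ⟧ ρ
ƛ⇛⇒▷* {M = M} {M′ = M′} r ρ =
  ⟦Λ⟧-resp _▷*_ (λ x → Star.gmap (lam x) (lam-red x)) (toCL M) (toCL M′) ρ ρ λ c → ⇛⇒▷* r (ρ ,, c)

Sƛ⇛⇒▷* : {M M′ N N′ : Lam (Maybe A)} → M ⇛ M′ → N ⇛ N′ → (ρ : A → Comb) →
         ⟦ toCL (Sₗ ∙ ƛ M ∙ ƛ N) ⟧ ρ ▷* ⟦ toCL (ƛ (M′ ∙ N′)) ⟧ ρ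
Sƛ⇛⇒▷* {M′ = M′} {N′ = N′} r s ρ =
  app* (app* ε (ƛ⇛⇒▷* r ρ)) (ƛ⇛⇒▷* s ρ) ◅◅ ⟦Λ⟧-S (toCL M′) (toCL N′) ρ

⇛⇒▷* ⇛-var ρ = ε
⇛⇒▷* ⇛-K ρ = ε
⇛⇒▷* ⇛-S ρ = ε
⇛⇒▷* (⇛-app r s) ρ = app* (⇛⇒▷* r ρ) (⇛⇒▷* s ρ)
⇛⇒▷* (⇛-ƛ r) ρ = ƛ⇛⇒▷* r ρ
⇛⇒▷* (⇛-β {M′ = M′} {N′ = N′} r s) ρ =
  app* (ƛ⇛⇒▷* r ρ) (⇛⇒▷* s ρ) ◅◅ ⟦toCL⟧-β M′ N′ ρ
⇛⇒▷* (⇛-K₁ {M′ = M′} r) ρ =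
  Star.gmap (K ·_) (app-r K) (⇛⇒▷* r ρ)
  ◅◅ reflexive _▷_ (sym (⟦Λ⟧-const (toCL (wk M′)) ρ λ c → ⟦toCL-ren⟧ just M′ (ρ ,, c)))
⇛⇒▷* (⇛-K₂ r) ρ = K-red _ _ ◅ ⇛⇒▷* r ρ
⇛⇒▷* (⇛-S₃ r s t) ρ =
  S-red _ _ _ ◅ app* (app* (⇛⇒▷* r ρ) (⇛⇒▷* t ρ)) (app* (⇛⇒▷* s ρ) (⇛⇒▷* t ρ))
⇛⇒▷* (⇛-Sƛ r s) ρ = Sƛ⇛⇒▷* r s ρ
⇛⇒▷* (⇛-Sƛβ {M′ = M′} {N′ = N′} {P′ = P′} r s t) ρ =
  app* (Sƛ⇛⇒▷* r s ρ) (⇛⇒▷* t ρ) ◅◅ ⟦toCL⟧-β (M′ ∙ N′) P′ ρ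

-- Translating combinators into λ-terms

embed : Comb → Lam ℕ
embed (var n) = ` n
embed K = Kₗ
embed S = Sₗ
embed I = ƛ (` nothing)
embed (u · v) = embed u ∙ embed v

⟦toCL-embed⟧ : (t : Comb) → ⟦ toCL (embed t) ⟧ var ≡ t
⟦toCL-embed⟧ (var n) = refl
⟦toCL-embed⟧ K = refl
⟦toCL-embed⟧ S = refl
⟦toCL-embed⟧ I = refl
⟦toCL-embed⟧ (u · v) = cong₂ _·_ (⟦toCL-embed⟧ u) (⟦toCL-embed⟧ v)

-- Turns the name x into the variable bound by ƛ.
unbind : ℕ → ℕ → Maybe ℕ
unbind x y = if occurs x (var y) then nothing else just y

unbind-fresh : ∀ {x} u → occurs x u ≡ false → ren (unbind x) (embed u) ≡ wk (embed u)
unbind-fresh {x} (var y) x∉y rewrite x∉y = refl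
unbind-fresh K _ = refl
unbind-fresh S _ = refl
unbind-fresh I _ = refl
unbind-fresh {x} (u · v) x∉uv = cong₂ _∙_
  (unbind-fresh u (∨-conicalˡ (occurs x u) _ x∉uv))
  (unbind-fresh v (∨-conicalʳ _ (occurs x v) x∉uv))

embed-lam : ∀ x u → Star _⇛_ (embed (lam x u)) (ƛ (ren (unbind x) (embed u)))
embed-lam x (var y) with occurs x (var y)
... | true = ε
... | false = ⇛-K₁ ⇛-var ◅ ε
embed-lam x K = ⇛-K₁ ⇛-K ◅ ε
embed-lam x S = ⇛-K₁ ⇛-S ◅ ε
embed-lam x I = ⇛-K₁ (⇛-refl _) ◅ ε
embed-lam x (u · v) with occurs x (u · v) in eq
... | false =
  ⇛-≡ (⇛-K₁ (⇛-refl _)) (cong ƛ (sym (unbind-fresh (u · v) eq))) ◅ ε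
... | true =
  Star.gmap (λ U → Sₗ ∙ U ∙ embed (lam x v)) (λ r → ⇛-app (⇛-app ⇛-S r) (⇛-refl _))
            (embed-lam x u)
  ◅◅ Star.gmap (Sₗ ∙ ƛ _ ∙_) (⇛-app (⇛-refl _)) (embed-lam x v)
  ◅◅ ⇛-Sƛ (⇛-refl _) (⇛-refl _) ◅ ε

▷⇒⇔ : ∀ {u v} → u ▷ v → EqClosure _⇛_ (embed u) (embed v)
▷⇒⇔ (K-red u v) = fwd (⇛-K₂ (⇛-refl _)) ◅ ε
▷⇒⇔ (S-red u v w) = fwd (⇛-S₃ (⇛-refl _) (⇛-refl _) (⇛-refl _)) ◅ ε
▷⇒⇔ (I-red u) = fwd (⇛-β ⇛-var (⇛-refl _)) ◅ ε
▷⇒⇔ (SK-red u v) =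
  fwd (⇛-app (⇛-app ⇛-S (⇛-K₁ (⇛-refl _))) (⇛-K₁ (⇛-refl _)))
  ◅ fwd (⇛-Sƛ (⇛-refl _) (⇛-refl _)) ◅ bwd (⇛-K₁ (⇛-refl _)) ◅ ε
▷⇒⇔ (app-l v r) = Eq.gmap (_∙ embed v) (λ s → ⇛-app s (⇛-refl _)) (▷⇒⇔ r)
▷⇒⇔ (app-r u r) = Eq.gmap (embed u ∙_) (⇛-app (⇛-refl _)) (▷⇒⇔ r)
▷⇒⇔ (lam-red x {u} {v} r) =
  a—↠b⇒a↔b (embed-lam x u)
  ◅◅ Eq.gmap (ƛ ∘ ren (unbind x)) (⇛-ƛ ∘ ⇛-ren (unbind x)) (▷⇒⇔ r)
  ◅◅ a—↠b⇒b↔a (embed-lam x v)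

▷*⇒⇔ : ∀ {u v} → u ▷* v → EqClosure _⇛_ (embed u) (embed v)
▷*⇒⇔ = Star.concat ∘ Star.gmap embed ▷⇒⇔

readback : ∀ {t N} → Star _⇛_ (embed t) N → t ▷* ⟦ toCL N ⟧ var
readback {t} rs = subst (_▷* _) (⟦toCL-embed⟧ t)
  (Star.concat (Star.gmap (λ M → ⟦ toCL M ⟧ var) (λ r → ⇛⇒▷* r var) rs))

proposition1 : ∀ {t t₁ t₂} → t ▷* t₁ → t ▷* t₂ →
    Σ Comb (λ t₃ → t₁ ▷* t₃ × t₂ ▷* t₃)
proposition1 r₁ r₂
  with confluent⇒joinable ⇛-confluent (Eq.symmetric _⇛_ (▷*⇒⇔ r₁) ◅◅ ▷*⇒⇔ r₂)
... | N , s₁ , s₂ = ⟦ toCL N ⟧ var , readback s₁ , readback s₂
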